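{- Let $\mathbb{k}$ be a commutative ring and $n\ge0$. Then $\widetilde{w}_0=\sum_{F\in\Sigma_n}(-1)^{n-\ell(F)}F$ in $\mathbb{k}\Sigma_n$.
   Context: $[n]=\{1,\ldots,n\}$; $S_n$ the symmetric group, $\mathbb{k}S_n$ its group algebra, $w_0(i)=n+1-i$. For a composition $\beta=(\beta_1,\ldots,\beta_k)$ of $n$ (positive integers with sum $n$) let $D(\beta)=\{\beta_1,\ldots,\beta_1+\cdots+\beta_{k-1}\}$ and $B_\beta=\sum_{w\in S_n:\operatorname{Des}w\subseteq D(\beta)}w$, where $\operatorname{Des}w=\{i\in[n-1]:w(i)>w(i+1)\}$; the $B_\beta$ are linearly independent, their span is the descent algebra $\mathcal{D}(S_n)$, and $w_0\in\mathcal{D}(S_n)$. A face of $[n]$ is a tuple $F=(F_1,\ldots,F_k)$ of nonempty pairwise disjoint sets with union $[n]$; $\ell(F)=k$; $\operatorname{type}F=(|F_1|,\ldots,|F_k|)$; $\Sigma_n$ is the set of faces and $\mathbb{k}\Sigma_n$ the free $\mathbb{k}$-module on $\Sigma_n$ (the face algebra). $\widetilde{B}_\beta=\sum_{F\in\Sigma_n:\operatorname{type}F=\beta}F$. $\rho:\mathcal{D}(S_n)\to\mathbb{k}\Sigma_n$ is the $\mathbb{k}$-linear map with $\rho(B_\beta)=\widetilde{B}_\beta$, and $\widetilde{w}_0:=\rho(w_0)$. -}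

module Defs where

open import Level using (Level; _⊔_)
open import Algebra.Bundles using (CommutativeRing)
open import Data.Nat as ℕ using (ℕ; zero; suc; _∸_; _<_)
open import Data.Fin as Fin using (Fin; toℕ; inject₁; opposite)
open import Data.Fin.Properties using (all?) renaming (_≟_ to _≟ᶠ_; _<?_ to _<ᶠ?_)
open import Data.Fin.Subset using (Subset; Nonempty; ∣_∣) renaming (_∈_ to _∈ₛ_)
open import Data.List using (List; []; _∷_; map; tabulate; foldr)
open import Data.Nat.ListAction using (sum)
open import Data.List.Relation.Unary.All using (All)
open import Data.List.Properties using (≡-dec)
open import Data.List.Membership.DecPropositional ℕ._≟_ using (_∈_; _∈?_)
open import Data.Product using (Σ; ∃; _×_; _,_; proj₁; proj₂)
open import Data.Unit using (⊤; tt)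
open import Data.Empty using (⊥)
open import Function.Definitions using (Injective)
open import Relation.Binary.PropositionalEquality using (_≡_; _≢_)
open import Relation.Nullary using (Dec; yes; no; does; _→-dec_)
open import Data.Bool using (if_then_else_)

-- Combinatorial notions (1-based conventions of the paper, encoded on Fin n
-- which is 0-based: position i : Fin n stands for i+1 ∈ [n]).

Perm : ℕ → Set
Perm n = Σ (Fin n → Fin n) (Injective _≡_ _≡_)

w₀ : (n : ℕ) → Perm n
w₀ n = opposite , λ {x} {y} eq → opp-inj x y eq
  where
  open import Data.Fin.Properties using (opposite-involutive)
  open import Relation.Binary.PropositionalEquality using (cong; trans; sym)
  opp-inj : (x y : Fin n) → opposite x ≡ opposite y → x ≡ y
  opp-inj x y eq = trans (sym (opposite-involutive x))
                     (trans (cong opposite eq) (opposite-involutive y))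

Composition : ℕ → Set
Composition n = Σ (List ℕ) (λ β → All (0 <_) β × sum β ≡ n)

D : List ℕ → List ℕ
D [] = []
D (b ∷ []) = []
D (b ∷ b' ∷ bs) = b ∷ map (b ℕ.+_) (D (b' ∷ bs))

-- Des w ⊆ D : every descent i ∈ [n-1] (w(i) > w(i+1)) lies in D.
-- For n = suc m, the 1-based descent index of the 0-based position
-- i : Fin m (comparing positions i and i+1) is suc (toℕ i).
DesSubset : {n : ℕ} → (Fin n → Fin n) → List ℕ → Set
DesSubset {zero} w S = ⊤
DesSubset {suc m} w S =
  (i : Fin m) → w (Fin.suc i) Fin.< w (inject₁ i) → suc (toℕ i) ∈ S

DesSubset? : {n : ℕ} → (w : Fin n → Fin n) → (S : List ℕ) → Dec (DesSubset w S)
DesSubset? {zero} w S = yes tt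
DesSubset? {suc m} w S =
  all? (λ i → (w (Fin.suc i) <ᶠ? w (inject₁ i)) →-dec (suc (toℕ i) ∈? S))

record Face (n : ℕ) : Set where
  field
    len      : ℕ
    block    : Fin len → Subset n
    nonempty : (j : Fin len) → Nonempty (block j)
    disjoint : (j j' : Fin len) → j ≢ j' → (x : Fin n) → x ∈ₛ block j → x ∈ₛ block j' → ⊥
    covers   : (x : Fin n) → ∃ λ j → x ∈ₛ block j

ℓ : {n : ℕ} → Face n → ℕ
ℓ F = Face.len F

type : {n : ℕ} → Face n → List ℕ
type F = tabulate (λ j → ∣ Face.block F j ∣)

-- Algebra over a commutative ring 𝕜.
-- Elements of the free module 𝕜S_n (resp. 𝕜Σ_n) are given by their
-- coefficient functions on the (finite) basis S_n (resp. Σ_n).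

module Over {c ℓ' : Level} (R : CommutativeRing c ℓ') where
  open CommutativeRing R

  kS : ℕ → Set c
  kS n = Perm n → Carrier

  kΣ : ℕ → Set c
  kΣ n = Face n → Carrier

  _≈S_ : {n : ℕ} → kS n → kS n → Set ℓ'
  x ≈S y = ∀ w → x w ≈ y w

  _≈Σ_ : {n : ℕ} → kΣ n → kΣ n → Set ℓ'
  x ≈Σ y = ∀ F → x F ≈ y F

  w₀-elt : (n : ℕ) → kS n
  w₀-elt n w = if does (all? (λ i → proj₁ w i ≟ᶠ opposite i)) then 1# else 0#

  B : {n : ℕ} → Composition n → kS n
  B β w = if does (DesSubset? (proj₁ w) (D (proj₁ β))) then 1# else 0#

  B̃ : {n : ℕ} → Composition n → kΣ n
  B̃ β F = if does (≡-dec ℕ._≟_ (type F) (proj₁ β)) then 1# else 0#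

  -- A finite 𝕜-linear combination Σ c_i β_i of compositions, i.e. a formal
  -- element of span{B_β}; evaluated in 𝕜S_n and (via ρ) in 𝕜Σ_n.
  LinComb : ℕ → Set c
  LinComb n = List (Carrier × Composition n)

  evalB : {n : ℕ} → LinComb n → kS n
  evalB xs w = foldr (λ p acc → proj₁ p * B (proj₂ p) w + acc) 0# xs

  ρ : {n : ℕ} → LinComb n → kΣ n
  ρ xs F = foldr (λ p acc → proj₁ p * B̃ (proj₂ p) F + acc) 0# xs

  sign : ℕ → Carrier
  sign zero = 1#
  sign (suc m) = - sign m

  altFaces : (n : ℕ) → kΣ n
  altFaces n F = sign (n ∸ ℓ F)

-- For n = 1 + m, encode a composition β of n by D(β) ⊆ [m] and a permutation w by Des w ⊆ [m].
-- Then B_β(w) = [Des w ⊆ D(β)], and w₀ is the only permutation with Des w = [m]. Every subset of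
-- [m] is a descent set, so Σ c_β B_β = w₀ says exactly that the coefficient function
-- S ↦ Σ_{D(β) = S} c_β has zeta transform (sums over supersets) equal to the indicator of [m].
-- Möbius inversion on the Boolean lattice makes that coefficient (-1)^{m - |S|}, which also gives
-- an expansion of w₀. Finally ρ(Σ c_β B_β)(F) = Σ_{β = type F} c_β is the coefficient at
-- S = D(type F), and ℓ(F) = 1 + |D(type F)|.
module Submission where

open import Defs
open import Level using (Level)
open import Algebra.Bundles using (CommutativeRing)
open import Data.Bool using (Bool; true; if_then_else_)
import Data.Bool.Properties as Bool
open import Data.Empty using (⊥)
open import Data.Fin as Fin using (Fin; zero; suc; toℕ; inject₁; fromℕ; opposite)
open import Data.Fin.Properties
  using ( all?; toℕ-injective; toℕ-inject₁; toℕ-fromℕ; toℕ<n; inject₁ℕ<; inject₁-injective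
        ; fromℕ≢inject₁; opposite-prop; suc-injective)
  renaming (_≟_ to _≟ᶠ_)
open import Data.Fin.Subset using (Subset; Side; inside; outside; ⊤; ∁; ∣_∣; _⊆_)
  renaming (_∈_ to _∈ˢ_; _∉_ to _∉ˢ_)
open import Data.Fin.Subset.Properties
  using (_⊆?_; ∈⊤; ⊆⊤; ⊆-antisym; ∣p∣≤n; ∣∁p∣≡n∸∣p∣; ∣⁅x⁆∣≡1; p⊆q⇒∣p∣≤∣q∣; x∈⁅y⁆⇒x≡y)
open import Data.Nat as ℕ using (ℕ; zero; suc; _∸_; _≤_; _<_; z<s; s≤s)
open import Data.List as List using (List; []; _∷_; map; length)
open import Data.List.Properties using (map-∘; length-tabulate; ≡-dec)
  renaming (tabulate-cong to List-tabulate-cong)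
open import Data.List.Membership.DecPropositional ℕ._≟_ using (_∈_; _∉_; _∈?_)
open import Data.List.Membership.Propositional.Properties using (∈-map⁺; ∈-map⁻)
open import Data.List.Relation.Unary.All using (All; []; _∷_)
open import Data.List.Relation.Unary.All.Properties using (tabulate⁺)
import Data.List.Relation.Unary.Any as Any
open import Data.Nat.ListAction using (sum)
open import Data.Nat.Properties
  using ( ≤-refl; ≤-trans; ≤-antisym; ≤-pred; n≤0⇒n≡0; 0∸n≡0; m≤m+n; ∸-monoʳ-<; n<1+n; m+n≤o⇒m≤o∸n
        ; module ≤-Reasoning)
open import Data.Product as Product using (Σ-syntax; ∃; _×_; _,_; proj₁; proj₂; map₁; map₂)
open import Data.Vec as Vec using ([]; _∷_; here; there)
open import Data.Vec.Properties using (lookup∘tabulate; lookup⇒[]=; []=⇒lookup; tabulate-cong)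
  renaming (≡-dec to Vec-≡-dec)
open import Function using (_∘_; case_of_; _⇔_; mk⇔; Equivalence)
open import Relation.Binary.PropositionalEquality
  using (_≡_; _≢_; refl; sym; trans; cong; cong₂; subst; subst₂; _≗_; module ≡-Reasoning)
open import Relation.Nullary using (Dec; yes; does; contradiction)
open import Relation.Nullary.Decidable using (dec-true; dec-false; does-⇔)
open import Relation.Unary using (Pred; Decidable)

open Equivalence using (to; from)

private
  variable
    m n k : ℕ

module Combinatorics where

  open import Algebra.Properties.CommutativeSemigroup using (interchange)
  open import Data.Nat using (_+_)
  open import Data.Nat.Properties using (+-comm; +-commutativeSemigroup)

  _≟ˢ_ : (S T : Subset m) → Dec (S ≡ T)
  _≟ˢ_ = Vec-≡-dec Bool._≟_

  does≡true⇒ : ∀ {p} {P : Set p} (P? : Dec P) → does P? ≡ true → P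
  does≡true⇒ (yes p) _ = p

  ∈-tabulate-does : ∀ {p} {P : Pred (Fin n) p} (P? : Decidable P) {i : Fin n} →
    i ∈ˢ Vec.tabulate (does ∘ P?) ⇔ P i
  ∈-tabulate-does P? {i} = mk⇔
    (λ i∈ → does≡true⇒ (P? i) (trans (sym (lookup∘tabulate _ i)) ([]=⇒lookup i∈)))
    (λ p → lookup⇒[]= i _ (trans (lookup∘tabulate _ i) (dec-true (P? i) p)))

  ≡⊤⇔∀∈ : {S : Subset n} → S ≡ ⊤ ⇔ (∀ i → i ∈ˢ S)
  ≡⊤⇔∀∈ = mk⇔ (λ { refl i → ∈⊤ }) (λ h → ⊆-antisym ⊆⊤ (λ {i} _ → h i))

  -- Descents

  descentSet : (Fin (suc m) → Fin k) → Subset m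
  descentSet w = Vec.tabulate (λ i → does (w (suc i) Fin.<? w (inject₁ i)))

  Descending : (Fin (suc m) → ℕ) → Set
  Descending {m} g = (j : Fin m) → g (suc j) < g (inject₁ j)

  descentSet≡⊤⇔Descending : (w : Fin (suc m) → Fin (suc m)) → descentSet w ≡ ⊤ ⇔ Descending (toℕ ∘ w)
  descentSet≡⊤⇔Descending w = mk⇔
    (λ e j → to (∈-tabulate-does P?) (to ≡⊤⇔∀∈ e j))
    (λ d → from ≡⊤⇔∀∈ (λ j → from (∈-tabulate-does P?) (d j)))
    where P? = λ i → w (suc i) Fin.<? w (inject₁ i)

  descending-zero : (g : Fin (suc m) → ℕ) → Descending g → ∀ i → toℕ i + g i ≤ g zero
  descending-zero g d zero = ≤-refl
  descending-zero {suc m} g d (suc j) = ≤-trans (s≤s (descending-zero (g ∘ suc) (d ∘ suc) j)) (d zero)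

  descending-last : (g : Fin (suc m) → ℕ) → Descending g → ∀ i → toℕ (opposite i) + g (fromℕ m) ≤ g i
  descending-last {zero} g d zero = ≤-refl
  descending-last {suc m} g d zero = ≤-trans (s≤s (descending-last (g ∘ suc) (d ∘ suc) zero)) (d zero)
  descending-last {suc m} g d (suc j) =
    subst (λ k → k + g (fromℕ (suc m)) ≤ g (suc j)) (sym (toℕ-inject₁ (opposite j)))
          (descending-last (g ∘ suc) (d ∘ suc) j)

  descending⇒≗opposite : (w : Fin (suc m) → Fin (suc m)) → Descending (toℕ ∘ w) → w ≗ opposite
  descending⇒≗opposite {m} w d i = toℕ-injective (≤-antisym upper lower)
    where
    open ≤-Reasoning
    upper : toℕ (w i) ≤ toℕ (opposite i)
    upper = begin
      toℕ (w i)            ≤⟨ m+n≤o⇒m≤o∸n (toℕ (w i)) w[i]+i≤m ⟩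
      m ∸ toℕ i            ≡⟨ opposite-prop i ⟨
      toℕ (opposite i)     ∎
      where
      w[i]+i≤m : toℕ (w i) + toℕ i ≤ m
      w[i]+i≤m = begin
        toℕ (w i) + toℕ i  ≡⟨ +-comm (toℕ (w i)) (toℕ i) ⟩
        toℕ i + toℕ (w i)  ≤⟨ descending-zero (toℕ ∘ w) d i ⟩
        toℕ (w zero)       ≤⟨ ≤-pred (toℕ<n (w zero)) ⟩
        m                  ∎
    lower : toℕ (opposite i) ≤ toℕ (w i)
    lower = ≤-trans (m≤m+n _ _) (descending-last (toℕ ∘ w) d i)

  opposite-descending : Descending (toℕ ∘ opposite {suc m})
  opposite-descending {m} j = begin-strict
    toℕ (opposite (suc j))       ≡⟨ opposite-prop (suc j) ⟩
    m ∸ suc (toℕ j)              <⟨ ∸-monoʳ-< (n<1+n (toℕ j)) (toℕ<n j) ⟩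
    m ∸ toℕ j                    ≡⟨ cong (m ∸_) (toℕ-inject₁ j) ⟨
    m ∸ toℕ (inject₁ j)          ≡⟨ opposite-prop (inject₁ j) ⟨
    toℕ (opposite (inject₁ j))   ∎
    where open ≤-Reasoning

  ≗opposite⇔descentSet≡⊤ : (w : Fin (suc m) → Fin (suc m)) → (∀ i → w i ≡ opposite i) ⇔ descentSet w ≡ ⊤
  ≗opposite⇔descentSet≡⊤ w = mk⇔
    (λ w≗opp → from (descentSet≡⊤⇔Descending w) (λ j →
      subst₂ _<_ (cong toℕ (sym (w≗opp (suc j)))) (cong toℕ (sym (w≗opp (inject₁ j)))) (opposite-descending j)))
    (descending⇒≗opposite w ∘ to (descentSet≡⊤⇔Descending w))

  inject₁-<⇔ : {i j : Fin n} → inject₁ i Fin.< inject₁ j ⇔ i Fin.< j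
  inject₁-<⇔ {i = i} {j} = mk⇔
    (subst₂ _<_ (toℕ-inject₁ i) (toℕ-inject₁ j))
    (subst₂ _<_ (sym (toℕ-inject₁ i)) (sym (toℕ-inject₁ j)))

  descentSet-∘ : ∀ {l} (h : Fin k → Fin l) → (∀ {x y} → h x Fin.< h y ⇔ x Fin.< y) →
    (w : Fin (suc m) → Fin k) → descentSet (h ∘ w) ≡ descentSet w
  descentSet-∘ h h-<⇔ w = tabulate-cong (λ i →
    does-⇔ h-<⇔ (h (w (suc i)) Fin.<? h (w (inject₁ i))) (w (suc i) Fin.<? w (inject₁ i)))

  realize : Subset m → Fin (suc m) → Fin (suc m)
  realize []            i       = i
  realize (inside  ∷ S) zero    = fromℕ _
  realize (inside  ∷ S) (suc i) = inject₁ (realize S i)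
  realize (outside ∷ S) zero    = zero
  realize (outside ∷ S) (suc i) = suc (realize S i)

  realize-injective : (S : Subset m) {i j : Fin (suc m)} → realize S i ≡ realize S j → i ≡ j
  realize-injective []            e = e
  realize-injective (inside  ∷ S) {zero}  {zero}  e = refl
  realize-injective (inside  ∷ S) {zero}  {suc j} e = contradiction e fromℕ≢inject₁
  realize-injective (inside  ∷ S) {suc i} {zero}  e = contradiction (sym e) fromℕ≢inject₁
  realize-injective (inside  ∷ S) {suc i} {suc j} e = cong suc (realize-injective S (inject₁-injective e))
  realize-injective (outside ∷ S) {zero}  {zero}  e = refl
  realize-injective (outside ∷ S) {suc i} {suc j} e = cong suc (realize-injective S (suc-injective e))

  realizePerm : Subset m → Perm (suc m)
  realizePerm S = realize S , realize-injective S

  descentSet-realize : (S : Subset m) → descentSet (realize S) ≡ S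
  descentSet-realize [] = refl
  descentSet-realize (inside ∷ S) = cong₂ _∷_
    (dec-true (_ Fin.<? _) (subst (toℕ (inject₁ (realize S zero)) <_) (sym (toℕ-fromℕ _)) (inject₁ℕ< _)))
    (trans (descentSet-∘ inject₁ inject₁-<⇔ (realize S)) (descentSet-realize S))
  descentSet-realize {suc m} (outside ∷ S) = cong₂ _∷_
    (dec-false (suc (realize S zero) Fin.<? Fin.zero {suc m}) (λ ()))
    (trans (descentSet-∘ suc (mk⇔ ≤-pred s≤s) (realize S)) (descentSet-realize S))

  -- Compositions

  toSubset : List ℕ → Subset m
  toSubset L = Vec.tabulate (λ i → does (suc (toℕ i) ∈? L))

  Dˢ : List ℕ → Subset m
  Dˢ β = toSubset (D β)

  DesSubset⇔⊆ : (w : Fin (suc m) → Fin (suc m)) (L : List ℕ) → DesSubset w L ⇔ descentSet w ⊆ toSubset L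
  DesSubset⇔⊆ w L = mk⇔
    (λ h {i} → from (∈-tabulate-does member?) ∘ h i ∘ to (∈-tabulate-does descent?))
    (λ h i → to (∈-tabulate-does member?) ∘ h ∘ from (∈-tabulate-does descent?))
    where
    descent? = λ i → w (suc i) Fin.<? w (inject₁ i)
    member?  = λ i → suc (toℕ i) ∈? L

  toSubset-suc : (L X : List ℕ) → (∀ {x} → suc (suc x) ∈ L ⇔ suc x ∈ X) →
    toSubset {suc m} L ≡ does (1 ∈? L) ∷ toSubset X
  toSubset-suc L X h = cong (_ ∷_) (tabulate-cong (λ i →
    does-⇔ h (suc (suc (toℕ i)) ∈? L) (suc (toℕ i) ∈? X)))

  suc∈map-suc⇔ : {x : ℕ} {X : List ℕ} → suc x ∈ map suc X ⇔ x ∈ X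
  suc∈map-suc⇔ = mk⇔ (λ p → case ∈-map⁻ suc p of λ { (_ , q , refl) → q }) (∈-map⁺ suc)

  0∉map-suc : {X : List ℕ} → 0 ∉ map suc X
  0∉map-suc p with () ← proj₂ (proj₂ (∈-map⁻ suc p))

  D-suc : (b : ℕ) (bs : List ℕ) → D (suc b ∷ bs) ≡ map suc (D (b ∷ bs))
  D-suc b []        = refl
  D-suc b (b' ∷ bs) = cong (suc b ∷_) (map-∘ (D (b' ∷ bs)))

  consSuc : ℕ × List ℕ → List ℕ
  consSuc (h , t) = suc h ∷ t

  -- consSuc (parts S) is the composition β of 1 + m with Dˢ β = S; its first part is stored
  -- decremented, so that it is visibly positive.
  parts : Subset m → ℕ × List ℕ
  parts []            = 0 , []
  parts (inside  ∷ S) = 0 , consSuc (parts S)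
  parts (outside ∷ S) = map₁ suc (parts S)

  parts-sum : (S : Subset m) → proj₁ (parts S) + sum (proj₂ (parts S)) ≡ m
  parts-sum []            = refl
  parts-sum (inside  ∷ S) = cong suc (parts-sum S)
  parts-sum (outside ∷ S) = cong suc (parts-sum S)

  parts-positive : (S : Subset m) → All (0 <_) (proj₂ (parts S))
  parts-positive []            = []
  parts-positive (inside  ∷ S) = z<s ∷ parts-positive S
  parts-positive (outside ∷ S) = parts-positive S

  length-parts : (S : Subset m) → length (proj₂ (parts S)) ≡ ∣ S ∣
  length-parts []            = refl
  length-parts (inside  ∷ S) = cong suc (length-parts S)
  length-parts (outside ∷ S) = length-parts S

  compositionOf : Subset m → Composition (suc m)
  compositionOf S = consSuc (parts S) , z<s ∷ parts-positive S , cong suc (parts-sum S)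

  Dˢ-compositionOf : (S : Subset m) → Dˢ (consSuc (parts S)) ≡ S
  Dˢ-compositionOf [] = refl
  Dˢ-compositionOf {suc m} (inside ∷ S) =
    trans (toSubset-suc (1 ∷ map suc X) X shift) (cong (inside ∷_) (Dˢ-compositionOf S))
    where
    X = D (consSuc (parts S))
    shift : ∀ {x} → suc (suc x) ∈ 1 ∷ map suc X ⇔ suc x ∈ X
    shift = mk⇔ (λ { (Any.here ()) ; (Any.there p) → to suc∈map-suc⇔ p }) (Any.there ∘ from suc∈map-suc⇔)
  Dˢ-compositionOf (outside ∷ S) = begin
    toSubset (D (consSuc (map₁ suc (parts S))))  ≡⟨ cong toSubset (D-suc (suc (proj₁ (parts S))) (proj₂ (parts S))) ⟩
    toSubset (map suc X)                          ≡⟨ toSubset-suc (map suc X) X suc∈map-suc⇔ ⟩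
    does (1 ∈? map suc X) ∷ toSubset X            ≡⟨ cong₂ _∷_ (dec-false (1 ∈? map suc X) 0∉X) (Dˢ-compositionOf S) ⟩
    outside ∷ S                                   ∎
    where
    open ≡-Reasoning
    X = D (consSuc (parts S))
    0∉X : 1 ∉ map suc X
    0∉X p = 0∉map-suc (subst (0 ∈_) (D-suc _ _) (to suc∈map-suc⇔ p))

  parts-surjective : (b : ℕ) (bs : List ℕ) → All (0 <_) bs → Σ[ S ∈ Subset (b + sum bs) ] parts S ≡ (b , bs)
  parts-surjective zero    []           []       = [] , refl
  parts-surjective zero    (suc c ∷ cs) (_ ∷ ps) = Product.map (inside ∷_) (cong (0 ,_) ∘ cong consSuc) (parts-surjective c cs ps)
  parts-surjective (suc b) bs           ps       = Product.map (outside ∷_) (cong (map₁ suc)) (parts-surjective b bs ps)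

  compositionOf-Dˢ : (β : Composition (suc m)) → consSuc (parts (Dˢ {m} (proj₁ β))) ≡ proj₁ β
  compositionOf-Dˢ (suc b ∷ bs , _ ∷ ps , refl) =
    let (S , parts-S) = parts-surjective b bs ps
        S-composes = cong consSuc parts-S
    in  trans (cong (consSuc ∘ parts) (trans (cong Dˢ (sym S-composes)) (Dˢ-compositionOf S))) S-composes

  Dˢ-injective : (β γ : Composition (suc m)) → Dˢ {m} (proj₁ β) ≡ Dˢ (proj₁ γ) → proj₁ β ≡ proj₁ γ
  Dˢ-injective β γ e = trans (sym (compositionOf-Dˢ β)) (trans (cong (consSuc ∘ parts) e) (compositionOf-Dˢ γ))

  length≡suc∣Dˢ∣ : (β : Composition (suc m)) → length (proj₁ β) ≡ suc ∣ Dˢ {m} (proj₁ β) ∣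
  length≡suc∣Dˢ∣ {m} β = trans (cong length (sym (compositionOf-Dˢ β))) (cong suc (length-parts (Dˢ {m} (proj₁ β))))

  composition-zero : (β : Composition 0) → proj₁ β ≡ []
  composition-zero ([]        , _      , _ ) = refl
  composition-zero (zero  ∷ _ , () ∷ _ , _ )
  composition-zero (suc _ ∷ _ , _      , ())

  -- Faces

  sum-tabulate-+ : (f g : Fin k → ℕ) →
    sum (List.tabulate (λ j → f j + g j)) ≡ sum (List.tabulate f) + sum (List.tabulate g)
  sum-tabulate-+ {zero}  f g = refl
  sum-tabulate-+ {suc k} f g =
    trans (cong (f zero + g zero +_) (sum-tabulate-+ (f ∘ suc) (g ∘ suc)))
          (interchange +-commutativeSemigroup (f zero) (g zero) _ _)

  sum-tabulate-0 : (f : Fin k → ℕ) → (∀ j → f j ≡ 0) → sum (List.tabulate f) ≡ 0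
  sum-tabulate-0 {zero}  f h = refl
  sum-tabulate-0 {suc k} f h = cong₂ _+_ (h zero) (sum-tabulate-0 (f ∘ suc) (h ∘ suc))

  sum-tabulate-single : (f : Fin k → ℕ) (j₀ : Fin k) → f j₀ ≡ 1 → (∀ j → j ≢ j₀ → f j ≡ 0) →
    sum (List.tabulate f) ≡ 1
  sum-tabulate-single f zero     h₀ h = cong₂ _+_ h₀ (sum-tabulate-0 (f ∘ suc) (λ j → h (suc j) (λ ())))
  sum-tabulate-single f (suc j₀) h₀ h =
    cong₂ _+_ (h zero (λ ())) (sum-tabulate-single (f ∘ suc) j₀ h₀ (λ j j≢j₀ → h (suc j) (j≢j₀ ∘ suc-injective)))

  ∣head∣ : Subset (suc n) → ℕ
  ∣head∣ p = ∣ Vec.head p ∷ [] ∣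

  ∣∣≡∣head∣+∣tail∣ : (p : Subset (suc n)) → ∣ p ∣ ≡ ∣head∣ p + ∣ Vec.tail p ∣
  ∣∣≡∣head∣+∣tail∣ (inside  ∷ p) = refl
  ∣∣≡∣head∣+∣tail∣ (outside ∷ p) = refl

  ∣head∣≡1 : (p : Subset (suc n)) → zero ∈ˢ p → ∣head∣ p ≡ 1
  ∣head∣≡1 (inside ∷ p) here = refl

  ∣head∣≡0 : (p : Subset (suc n)) → zero ∉ˢ p → ∣head∣ p ≡ 0
  ∣head∣≡0 (inside  ∷ p) 0∉p = contradiction here 0∉p
  ∣head∣≡0 (outside ∷ p) 0∉p = refl

  ∈tail⇔suc∈ : {x : Fin n} (p : Subset (suc n)) → x ∈ˢ Vec.tail p ⇔ suc x ∈ˢ p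
  ∈tail⇔suc∈ (_ ∷ p) = mk⇔ there (λ { (there x∈p) → x∈p })

  ∈⇒0<∣∣ : {x : Fin n} {p : Subset n} → x ∈ˢ p → 0 < ∣ p ∣
  ∈⇒0<∣∣ {x = x} x∈p =
    subst (_≤ _) (∣⁅x⁆∣≡1 x) (p⊆q⇒∣p∣≤∣q∣ (λ y∈⁅x⁆ → subst (_∈ˢ _) (sym (x∈⁅y⁆⇒x≡y x y∈⁅x⁆)) x∈p))

  module _ {k n : ℕ} (f : Fin k → Subset n) where

    PairwiseDisjoint : Set
    PairwiseDisjoint = ∀ j j' → j ≢ j' → ∀ x → x ∈ˢ f j → x ∈ˢ f j' → ⊥

    Covering : Set
    Covering = ∀ x → ∃ λ j → x ∈ˢ f j

  sum-∣partition∣ : (f : Fin k → Subset n) → PairwiseDisjoint f → Covering f → sum (List.tabulate (∣_∣ ∘ f)) ≡ n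
  sum-∣partition∣ {n = zero}  f _ _ = sum-tabulate-0 _ (λ j → n≤0⇒n≡0 (∣p∣≤n (f j)))
  sum-∣partition∣ {n = suc n} f disjoint covers = begin
    sum (List.tabulate (∣_∣ ∘ f))                                       ≡⟨ cong sum (List-tabulate-cong (∣∣≡∣head∣+∣tail∣ ∘ f)) ⟩
    sum (List.tabulate (λ j → ∣head∣ (f j) + ∣ Vec.tail (f j) ∣))       ≡⟨ sum-tabulate-+ (∣head∣ ∘ f) (∣_∣ ∘ tails) ⟩
    sum (List.tabulate (∣head∣ ∘ f)) + sum (List.tabulate (∣_∣ ∘ tails)) ≡⟨ cong₂ _+_ heads (sum-∣partition∣ tails disjoint′ covers′) ⟩
    1 + n                                                               ∎
    where
    open ≡-Reasoning
    j₀ = proj₁ (covers zero)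
    heads : sum (List.tabulate (∣head∣ ∘ f)) ≡ 1
    heads = sum-tabulate-single _ j₀ (∣head∣≡1 (f j₀) (proj₂ (covers zero)))
              (λ j j≢j₀ → ∣head∣≡0 (f j) (λ 0∈ → disjoint j j₀ j≢j₀ zero 0∈ (proj₂ (covers zero))))
    tails : Fin _ → Subset n
    tails = Vec.tail ∘ f
    disjoint′ : PairwiseDisjoint tails
    disjoint′ j j' j≢j' x x∈ x∈' =
      disjoint j j' j≢j' (suc x) (to (∈tail⇔suc∈ (f j)) x∈) (to (∈tail⇔suc∈ (f j')) x∈')
    covers′ : Covering tails
    covers′ x = Product.map₂ (λ {j} → from (∈tail⇔suc∈ (f j))) (covers (suc x))

  typeComposition : Face n → Composition n
  typeComposition F = type F
    , tabulate⁺ (λ j → let (x , x∈) = Face.nonempty F j in ∈⇒0<∣∣ x∈)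
    , sum-∣partition∣ (Face.block F) (Face.disjoint F) (Face.covers F)

  suc∸ℓ≡∣∁Dˢtype∣ : (F : Face (suc m)) → suc m ∸ ℓ F ≡ ∣ ∁ (Dˢ {m} (type F)) ∣
  suc∸ℓ≡∣∁Dˢtype∣ {m} F = begin
    suc m ∸ ℓ F                  ≡⟨ cong (suc m ∸_) (length-tabulate (∣_∣ ∘ Face.block F)) ⟨
    suc m ∸ length (type F)      ≡⟨ cong (suc m ∸_) (length≡suc∣Dˢ∣ (typeComposition F)) ⟩
    m ∸ ∣ Dˢ {m} (type F) ∣      ≡⟨ ∣∁p∣≡n∸∣p∣ (Dˢ {m} (type F)) ⟨
    ∣ ∁ (Dˢ {m} (type F)) ∣      ∎
    where open ≡-Reasoning

open Combinatorics

-- The descent algebra and the face algebra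

module _ {c ℓ' : Level} (R : CommutativeRing c ℓ') where

  open CommutativeRing R renaming (refl to ≈-refl; sym to ≈-sym; trans to ≈-trans)
  open Over R
  open import Algebra.Properties.Ring ring using (-0#≈0#; -‿distribˡ-*; -‿distribʳ-*; x[y-z]≈xy-xz; +-inverseʳ-unique)
  open import Algebra.Properties.CommutativeSemigroup +-commutativeSemigroup using (x∙yz≈y∙xz)
  open import Relation.Binary.Reasoning.Setoid setoid

  𝟙 : Bool → Carrier
  𝟙 b = if b then 1# else 0#

  lincomb : {A : Set} → List (Carrier × A) → (A → Carrier) → Carrier
  lincomb ys f = List.foldr (λ p acc → proj₁ p * f (proj₂ p) + acc) 0# ys

  lincomb-cong : {A : Set} (ys : List (Carrier × A)) {f g : A → Carrier} → (∀ a → f a ≈ g a) → lincomb ys f ≈ lincomb ys g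
  lincomb-cong []             h = ≈-refl
  lincomb-cong ((c , a) ∷ ys) h = +-cong (*-cong ≈-refl (h a)) (lincomb-cong ys h)

  lincomb-cong≡ : {A : Set} (ys : List (Carrier × A)) {f g : A → Carrier} → f ≗ g → lincomb ys f ≡ lincomb ys g
  lincomb-cong≡ []             h = refl
  lincomb-cong≡ ((c , a) ∷ ys) h = cong₂ (λ x y → c * x + y) (h a) (lincomb-cong≡ ys h)

  lincomb-zero : {A : Set} (ys : List (Carrier × A)) {f : A → Carrier} → (∀ a → f a ≈ 0#) → lincomb ys f ≈ 0#
  lincomb-zero []             h = ≈-refl
  lincomb-zero ((c , a) ∷ ys) h = begin
    c * _ + lincomb ys _  ≈⟨ +-cong (*-cong ≈-refl (h a)) (lincomb-zero ys h) ⟩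
    c * 0# + 0#           ≈⟨ +-identityʳ _ ⟩
    c * 0#                ≈⟨ zeroʳ c ⟩
    0#                    ∎

  lincomb-map₂ : {A B : Set} (g : A → B) (ys : List (Carrier × A)) {f : B → Carrier} →
    lincomb (map (map₂ g) ys) f ≡ lincomb ys (f ∘ g)
  lincomb-map₂ g []             = refl
  lincomb-map₂ g ((c , a) ∷ ys) = cong (c * _ +_) (lincomb-map₂ g ys)

  ζ : List (Carrier × Subset m) → Subset m → Carrier
  ζ ys S = lincomb ys (λ T → 𝟙 (does (S ⊆? T)))

  coeff : List (Carrier × Subset m) → Subset m → Carrier
  coeff ys T = lincomb ys (λ U → 𝟙 (does (U ≟ˢ T)))

  δ⊤ : Subset m → Carrier
  δ⊤ S = 𝟙 (does (S ≟ˢ ⊤))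

  extend : List (Carrier × Subset m) → List (Carrier × Subset (suc m))
  extend []             = []
  extend ((c , S) ∷ ys) = (c , inside ∷ S) ∷ (- c , outside ∷ S) ∷ extend ys

  lincomb-extend : (ys : List (Carrier × Subset m)) (f : Subset (suc m) → Carrier) →
    lincomb (extend ys) f ≈ lincomb ys (λ S → f (inside ∷ S) - f (outside ∷ S))
  lincomb-extend []             f = ≈-refl
  lincomb-extend ((c , S) ∷ ys) f = begin
    c * x + (- c * y + lincomb (extend ys) f)  ≈⟨ +-congˡ (+-cong (≈-sym (-‿distribˡ-* c y)) (lincomb-extend ys f)) ⟩
    c * x + (- (c * y) + r)                    ≈⟨ +-assoc _ _ _ ⟨
    c * x - c * y + r                          ≈⟨ +-congʳ (x[y-z]≈xy-xz c x y) ⟨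
    c * (x - y) + r                            ∎
    where
    x = f (inside ∷ S)
    y = f (outside ∷ S)
    r = lincomb ys (λ S → f (inside ∷ S) - f (outside ∷ S))

  -- Σ_S (-1)^{m - |S|} S, i.e. the Möbius function S ↦ μ(S, ⊤) of the Boolean lattice
  signedSubsets : (m : ℕ) → List (Carrier × Subset m)
  signedSubsets zero    = (1# , []) ∷ []
  signedSubsets (suc m) = extend (signedSubsets m)

  ζ-signedSubsets : (S : Subset m) → ζ (signedSubsets m) S ≈ δ⊤ S
  ζ-signedSubsets [] = ≈-trans (+-identityʳ _) (*-identityˡ 1#)
  ζ-signedSubsets {suc m} (inside ∷ S) = begin
    ζ (extend ys) (inside ∷ S)                    ≈⟨ lincomb-extend ys _ ⟩
    lincomb ys (λ T → 𝟙 (does (S ⊆? T)) - 0#)     ≈⟨ lincomb-cong ys (λ _ → ≈-trans (+-congˡ -0#≈0#) (+-identityʳ _)) ⟩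
    ζ ys S                                         ≈⟨ ζ-signedSubsets S ⟩
    δ⊤ S                                           ∎
    where ys = signedSubsets m
  ζ-signedSubsets {suc m} (outside ∷ S) = begin
    ζ (extend ys) (outside ∷ S)                   ≈⟨ lincomb-extend ys _ ⟩
    lincomb ys (λ T → ζ′ T - ζ′ T)                ≈⟨ lincomb-zero ys (λ T → -‿inverseʳ (ζ′ T)) ⟩
    0#                                             ∎
    where
    ys = signedSubsets m
    ζ′ = λ T → 𝟙 (does (S ⊆? T))

  slice : Side → List (Carrier × Subset (suc m)) → List (Carrier × Subset m)
  slice _       []                         = []
  slice inside  ((c , inside  ∷ S) ∷ ys)   = (c , S) ∷ slice inside ys
  slice inside  ((c , outside ∷ S) ∷ ys)   = slice inside ys
  slice outside ((c , inside  ∷ S) ∷ ys)   = slice outside ys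
  slice outside ((c , outside ∷ S) ∷ ys)   = (c , S) ∷ slice outside ys

  lincomb-slice : (ys : List (Carrier × Subset (suc m))) (f : Subset (suc m) → Carrier) →
    lincomb ys f ≈ lincomb (slice inside ys) (f ∘ (inside ∷_)) + lincomb (slice outside ys) (f ∘ (outside ∷_))
  lincomb-slice []                       f = ≈-sym (+-identityˡ 0#)
  lincomb-slice ((c , inside  ∷ S) ∷ ys) f = ≈-trans (+-congˡ (lincomb-slice ys f)) (≈-sym (+-assoc _ _ _))
  lincomb-slice ((c , outside ∷ S) ∷ ys) f = ≈-trans (+-congˡ (lincomb-slice ys f)) (x∙yz≈y∙xz _ _ _)

  lincomb-slice-inside : (ys : List (Carrier × Subset (suc m))) {f : Subset (suc m) → Carrier} →
    (∀ S → f (outside ∷ S) ≈ 0#) → lincomb ys f ≈ lincomb (slice inside ys) (f ∘ (inside ∷_))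
  lincomb-slice-inside ys {f} f≈0 = begin
    lincomb ys f                                                              ≈⟨ lincomb-slice ys f ⟩
    lincomb (slice inside ys) (f ∘ (inside ∷_)) + lincomb (slice outside ys) _ ≈⟨ +-congˡ (lincomb-zero (slice outside ys) f≈0) ⟩
    lincomb (slice inside ys) (f ∘ (inside ∷_)) + 0#                          ≈⟨ +-identityʳ _ ⟩
    lincomb (slice inside ys) (f ∘ (inside ∷_))                               ∎

  lincomb-slice-outside : (ys : List (Carrier × Subset (suc m))) {f : Subset (suc m) → Carrier} →
    (∀ S → f (inside ∷ S) ≈ 0#) → lincomb ys f ≈ lincomb (slice outside ys) (f ∘ (outside ∷_))
  lincomb-slice-outside ys {f} f≈0 = begin
    lincomb ys f                                                                ≈⟨ lincomb-slice ys f ⟩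
    lincomb (slice inside ys) _ + lincomb (slice outside ys) (f ∘ (outside ∷_)) ≈⟨ +-congʳ (lincomb-zero (slice inside ys) f≈0) ⟩
    0# + lincomb (slice outside ys) (f ∘ (outside ∷_))                          ≈⟨ +-identityˡ _ ⟩
    lincomb (slice outside ys) (f ∘ (outside ∷_))                               ∎

  module _ (a : Carrier) (ys : List (Carrier × Subset (suc m))) (ζys : ∀ S → ζ ys S ≈ a * δ⊤ S) where

    ζ-slice-inside : ∀ S → ζ (slice inside ys) S ≈ a * δ⊤ S
    ζ-slice-inside S = ≈-trans (≈-sym (lincomb-slice-inside ys (λ _ → ≈-refl))) (ζys (inside ∷ S))

    ζ-slice-outside : ∀ S → ζ (slice outside ys) S ≈ - a * δ⊤ S
    ζ-slice-outside S = begin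
      ζ (slice outside ys) S     ≈⟨ +-inverseʳ-unique _ _ ζ-slices-sum ⟩
      - ζ (slice inside ys) S    ≈⟨ -‿cong (ζ-slice-inside S) ⟩
      - (a * δ⊤ S)               ≈⟨ -‿distribˡ-* a _ ⟩
      - a * δ⊤ S                 ∎
      where
      ζ-slices-sum : ζ (slice inside ys) S + ζ (slice outside ys) S ≈ 0#
      ζ-slices-sum = ≈-trans (≈-sym (lincomb-slice ys _)) (≈-trans (ζys (outside ∷ S)) (zeroʳ a))

  möbius : (a : Carrier) (ys : List (Carrier × Subset m)) →
    (∀ S → ζ ys S ≈ a * δ⊤ S) → ∀ T → coeff ys T ≈ a * sign ∣ ∁ T ∣
  möbius {zero} a ys ζys [] = begin
    coeff ys []   ≡⟨ lincomb-cong≡ ys (λ { [] → refl }) ⟩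
    ζ ys []       ≈⟨ ζys [] ⟩
    a * 1#        ∎
  möbius {suc m} a ys ζys (inside ∷ T) = begin
    coeff ys (inside ∷ T)          ≈⟨ lincomb-slice-inside ys (λ _ → ≈-refl) ⟩
    coeff (slice inside ys) T      ≈⟨ möbius a (slice inside ys) (ζ-slice-inside a ys ζys) T ⟩
    a * sign ∣ ∁ T ∣               ∎
  möbius {suc m} a ys ζys (outside ∷ T) = begin
    coeff ys (outside ∷ T)         ≈⟨ lincomb-slice-outside ys (λ _ → ≈-refl) ⟩
    coeff (slice outside ys) T     ≈⟨ möbius (- a) (slice outside ys) (ζ-slice-outside a ys ζys) T ⟩
    - a * sign ∣ ∁ T ∣             ≈⟨ -‿distribˡ-* a _ ⟨
    - (a * sign ∣ ∁ T ∣)           ≈⟨ -‿distribʳ-* a _ ⟩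
    a * - sign ∣ ∁ T ∣             ∎

  B≡𝟙⊆ : (β : Composition (suc m)) (w : Perm (suc m)) →
    B β w ≡ 𝟙 (does (descentSet (proj₁ w) ⊆? Dˢ {m} (proj₁ β)))
  B≡𝟙⊆ β (w , _) = cong 𝟙 (does-⇔ (DesSubset⇔⊆ w L) (DesSubset? w L) (descentSet w ⊆? Dˢ (proj₁ β)))
    where L = D (proj₁ β)

  w₀-elt≡δ⊤ : (w : Perm (suc m)) → w₀-elt (suc m) w ≡ δ⊤ (descentSet (proj₁ w))
  w₀-elt≡δ⊤ (w , _) =
    cong 𝟙 (does-⇔ (≗opposite⇔descentSet≡⊤ w) (all? (λ i → w i ≟ᶠ opposite i)) (descentSet w ≟ˢ ⊤))

  B-realizePerm : (β : Composition (suc m)) (S : Subset m) → B β (realizePerm S) ≡ 𝟙 (does (S ⊆? Dˢ (proj₁ β)))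
  B-realizePerm β S = trans (B≡𝟙⊆ β (realizePerm S)) (cong (λ U → 𝟙 (does (U ⊆? Dˢ (proj₁ β)))) (descentSet-realize S))

  w₀-elt-realizePerm : (S : Subset m) → w₀-elt (suc m) (realizePerm S) ≡ δ⊤ S
  w₀-elt-realizePerm S = trans (w₀-elt≡δ⊤ (realizePerm S)) (cong δ⊤ (descentSet-realize S))

  B̃≡𝟙≡ : (β : Composition (suc m)) (F : Face (suc m)) →
    B̃ β F ≡ 𝟙 (does (Dˢ {m} (proj₁ β) ≟ˢ Dˢ (type F)))
  B̃≡𝟙≡ {m} β F =
    cong 𝟙 (does-⇔ type≡β⇔Dˢ≡ (≡-dec ℕ._≟_ (type F) (proj₁ β)) (Dˢ (proj₁ β) ≟ˢ Dˢ (type F)))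
    where
    type≡β⇔Dˢ≡ : type F ≡ proj₁ β ⇔ Dˢ {m} (proj₁ β) ≡ Dˢ (type F)
    type≡β⇔Dˢ≡ = mk⇔ (cong Dˢ ∘ sym) (sym ∘ Dˢ-injective β (typeComposition F))

  w₀-expansion : (m : ℕ) → LinComb (suc m)
  w₀-expansion m = map (map₂ compositionOf) (signedSubsets m)

  evalB-w₀-expansion : (m : ℕ) → evalB (w₀-expansion m) ≈S w₀-elt (suc m)
  evalB-w₀-expansion m w = begin
    evalB (w₀-expansion m) w                               ≡⟨ lincomb-map₂ compositionOf (signedSubsets m) ⟩
    lincomb (signedSubsets m) (λ S → B (compositionOf S) w) ≡⟨ lincomb-cong≡ (signedSubsets m) B≡𝟙⊆descentSet ⟩
    ζ (signedSubsets m) (descentSet (proj₁ w))             ≈⟨ ζ-signedSubsets (descentSet (proj₁ w)) ⟩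
    δ⊤ (descentSet (proj₁ w))                              ≡⟨ w₀-elt≡δ⊤ w ⟨
    w₀-elt (suc m) w                                       ∎
    where
    B≡𝟙⊆descentSet : ∀ S → B (compositionOf S) w ≡ 𝟙 (does (descentSet (proj₁ w) ⊆? S))
    B≡𝟙⊆descentSet S = trans (B≡𝟙⊆ (compositionOf S) w)
                              (cong (λ T → 𝟙 (does (descentSet (proj₁ w) ⊆? T))) (Dˢ-compositionOf S))

  ρ-unique : (m : ℕ) (xs : LinComb (suc m)) → evalB xs ≈S w₀-elt (suc m) → ρ xs ≈Σ altFaces (suc m)
  ρ-unique m xs evalB≈w₀ F = begin
    ρ xs F                                            ≡⟨ lincomb-cong≡ xs (λ β → B̃≡𝟙≡ β F) ⟩
    lincomb xs (λ β → 𝟙 (does (Dˢ (proj₁ β) ≟ˢ T)))   ≡⟨ lincomb-map₂ (Dˢ ∘ proj₁) xs ⟨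
    coeff ys T                                        ≈⟨ möbius 1# ys ζys T ⟩
    1# * sign ∣ ∁ T ∣                                 ≈⟨ *-identityˡ _ ⟩
    sign ∣ ∁ T ∣                                      ≡⟨ cong sign (suc∸ℓ≡∣∁Dˢtype∣ F) ⟨
    sign (suc m ∸ ℓ F)                                ∎
    where
    T = Dˢ {m} (type F)
    ys = map (map₂ (Dˢ ∘ proj₁)) xs
    ζys : ∀ S → ζ ys S ≈ 1# * δ⊤ S
    ζys S = begin
      ζ ys S                                            ≡⟨ lincomb-map₂ (Dˢ ∘ proj₁) xs ⟩
      lincomb xs (λ β → 𝟙 (does (S ⊆? Dˢ (proj₁ β))))  ≡⟨ lincomb-cong≡ xs (λ β → B-realizePerm β S) ⟨
      evalB xs (realizePerm S)                          ≈⟨ evalB≈w₀ (realizePerm S) ⟩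
      w₀-elt (suc m) (realizePerm S)                    ≡⟨ w₀-elt-realizePerm S ⟩
      δ⊤ S                                              ≈⟨ *-identityˡ _ ⟨
      1# * δ⊤ S                                         ∎

  w₀-expansion₀ : LinComb 0
  w₀-expansion₀ = (1# , [] , [] , refl) ∷ []

  evalB-w₀-expansion₀ : evalB w₀-expansion₀ ≈S w₀-elt 0
  evalB-w₀-expansion₀ w = ≈-trans (+-identityʳ _) (*-identityˡ 1#)

  -- For n = 0 all of B β, B̃ β and w₀-elt 0 are the constant 1#.
  ρ-unique₀ : (xs : LinComb 0) → evalB xs ≈S w₀-elt 0 → ρ xs ≈Σ altFaces 0
  ρ-unique₀ xs evalB≈w₀ F = begin
    ρ xs F               ≡⟨ lincomb-cong≡ xs (λ β → cong 𝟙 (dec-true (≡-dec ℕ._≟_ (type F) (proj₁ β)) (type≡ β))) ⟩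
    evalB xs (w₀ 0)      ≈⟨ evalB≈w₀ (w₀ 0) ⟩
    1#                   ≡⟨ cong sign (0∸n≡0 (ℓ F)) ⟨
    sign (0 ∸ ℓ F)       ∎
    where
    type≡ : (β : Composition 0) → type F ≡ proj₁ β
    type≡ β = trans (composition-zero (typeComposition F)) (sym (composition-zero β))

proposition4p14 : {c ℓ' : Level} (R : CommutativeRing c ℓ') (n : ℕ) →
    let open Over R in
    (∃ λ xs → evalB xs ≈S w₀-elt n)
    × ((xs : LinComb n) → evalB xs ≈S w₀-elt n → ρ xs ≈Σ altFaces n)
proposition4p14 R zero    = (w₀-expansion₀ R , evalB-w₀-expansion₀ R) , ρ-unique₀ R
proposition4p14 R (suc m) = (w₀-expansion R m , evalB-w₀-expansion R m) , ρ-unique R m
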